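{- Let $S=\langle d_0,d_1,d_2,d_3\rangle$ be a numerical semigroup with embedding dimension four. Form the collection $R$ from the initial collection of cubes by deleting: (i) the region associated to every point $(a_{01},a_{02},a_{03})\in\mathbb N^3$ with $a_{00}d_0=a_{01}d_1+a_{02}d_2+a_{03}d_3$; (ii) the regions associated to the points $(b_{11},-b_{12},-b_{13})$, $(-b_{21},b_{22},-b_{23})$, $(-b_{31},-b_{32},b_{33})$ coming from the $d_0$-positive minimal relations; (iii) for every identity $\lambda_0d_0+\lambda_1d_1=\lambda_2d_2+\lambda_3d_3$ with $\lambda_i\in\mathbb N$, $\lambda_0>0$, $\lambda_2<b_{22}$, $\lambda_3<b_{33}$, the region associated to $(-\lambda_1,\lambda_2,\lambda_3)$; for every identity $\lambda_0d_0+\lambda_2d_2=\lambda_1d_1+\lambda_3d_3$ with $\lambda_i\in\mathbb N$, $\lambda_0>0$, $\lambda_1<b_{11}$, $\lambda_3<b_{33}$, the region associated to $(\lambda_1,-\lambda_2,\lambda_3)$; and for every identity $\lambda_0d_0+\lambda_3d_3=\lambda_1d_1+\lambda_2d_2$ with $\lambda_i\in\mathbb N$, $\lambda_0>0$, $\lambda_1<b_{11}$, $\lambda_2<b_{22}$, the region associated to $(\lambda_1,\lambda_2,-\lambda_3)$. Then $R$ is exactly the set of cubes of the initial collection whose labels belong to $\mathrm{Ap}(S,d_0)$.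
   Context: $S=\langle d_0,d_1,d_2,d_3\rangle$ is the set of nonnegative integer combinations of positive integers $d_0,\dots,d_3$ with $\gcd=1$, which are its minimal generators. $\mathrm{Ap}(S,d_0)=\{s\in S: s-d_0\notin S\}$. For $(i,j,k)\in\mathbb N^3$ the cube $[[i,j,k]]=[i,i+1]\times[j,j+1]\times[k,k+1]$ is labeled with $id_1+jd_2+kd_3$; the initial collection of cubes consists of all these labeled cubes. For $P=(a,b,c)\in\mathbb Z^3$ the region associated to $P$ is $\{x>a,y>b,z>c\}$; deleting it removes every cube $[[i,j,k]]$ with $i\ge a$, $j\ge b$, $k\ge c$. The integer $a_{00}$ is the least positive integer such that $a_{00}d_0=a_{01}d_1+a_{02}d_2+a_{03}d_3$ for some $a_{0j}\in\mathbb N$. For $i\in\{1,2,3\}$, $b_{ii}$ is the least positive integer such that $b_{ii}d_i=\sum_{j\ne i}b_{ij}d_j$ for some $b_{ij}\in\mathbb N$ with $b_{i0}>0$ (the $d_0$-positive minimal relations); the $b_{ij}$, $j\ne i$, are fixed coefficients realizing these relations. -}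

module Defs where

open import Data.Nat as ℕ using (ℕ; _+_; _*_; _<_; _≤_)
open import Data.Nat.GCD using (gcd)
open import Data.Integer as ℤ using (ℤ; +_; -_)
open import Data.Product using (Σ; ∃; _×_; _,_)
open import Relation.Binary.PropositionalEquality using (_≡_)
open import Relation.Nullary using (¬_)

InS : (d0 d1 d2 d3 s : ℕ) → Set
InS d0 d1 d2 d3 s =
  Σ ℕ λ c0 → Σ ℕ λ c1 → Σ ℕ λ c2 → Σ ℕ λ c3 →
    s ≡ c0 * d0 + c1 * d1 + c2 * d2 + c3 * d3

InSpan3 : (a b c x : ℕ) → Set
InSpan3 a b c x = Σ ℕ λ u → Σ ℕ λ v → Σ ℕ λ w → x ≡ u * a + v * b + w * c

EmbDim4 : (d0 d1 d2 d3 : ℕ) → Set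
EmbDim4 d0 d1 d2 d3 =
  (0 < d0 × 0 < d1 × 0 < d2 × 0 < d3) ×
  gcd (gcd d0 d1) (gcd d2 d3) ≡ 1 ×
  ¬ InSpan3 d1 d2 d3 d0 × ¬ InSpan3 d0 d2 d3 d1 ×
  ¬ InSpan3 d0 d1 d3 d2 × ¬ InSpan3 d0 d1 d2 d3

-- Apéry set: s ∈ S and s - d0 ∉ S (with s - d0 taken in ℤ, so s < d0
-- means s - d0 ∉ S automatically).
Ap : (d0 d1 d2 d3 s : ℕ) → Set
Ap d0 d1 d2 d3 s =
  InS d0 d1 d2 d3 s × ¬ (Σ ℕ λ t → InS d0 d1 d2 d3 t × t + d0 ≡ s)

IsA00 : (d0 d1 d2 d3 a00 : ℕ) → Set
IsA00 d0 d1 d2 d3 a00 =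
  0 < a00 × InSpan3 d1 d2 d3 (a00 * d0) ×
  (∀ m → 0 < m → InSpan3 d1 d2 d3 (m * d0) → a00 ≤ m)

IsD0PosMinRel : (d d0 x y b b0 bx by : ℕ) → Set
IsD0PosMinRel d d0 x y b b0 bx by =
  0 < b × 0 < b0 × b * d ≡ b0 * d0 + bx * x + by * y ×
  (∀ m → 0 < m →
     (Σ ℕ λ c0 → Σ ℕ λ cx → Σ ℕ λ cy →
        0 < c0 × m * d ≡ c0 * d0 + cx * x + cy * y) → b ≤ m)

-- The region associated to P = (a,b,c) deletes the cube [[i,j,k]] iff
-- i ≥ a, j ≥ b, k ≥ c.
RegionDeletes : (a b c : ℤ) (i j k : ℕ) → Set
RegionDeletes a b c i j k = a ℤ.≤ + i × b ℤ.≤ + j × c ℤ.≤ + k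

data DeletedPoint (d0 d1 d2 d3 a00 b11 b12 b13 b21 b22 b23 b31 b32 b33 : ℕ)
     : ℤ → ℤ → ℤ → Set where
  ptA   : (a01 a02 a03 : ℕ) → a00 * d0 ≡ a01 * d1 + a02 * d2 + a03 * d3 →
          DeletedPoint d0 d1 d2 d3 a00 b11 b12 b13 b21 b22 b23 b31 b32 b33
            (+ a01) (+ a02) (+ a03)
  ptB1  : DeletedPoint d0 d1 d2 d3 a00 b11 b12 b13 b21 b22 b23 b31 b32 b33
            (+ b11) (- (+ b12)) (- (+ b13))
  ptB2  : DeletedPoint d0 d1 d2 d3 a00 b11 b12 b13 b21 b22 b23 b31 b32 b33
            (- (+ b21)) (+ b22) (- (+ b23))
  ptB3  : DeletedPoint d0 d1 d2 d3 a00 b11 b12 b13 b21 b22 b23 b31 b32 b33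
            (- (+ b31)) (- (+ b32)) (+ b33)
  ptL1  : (l0 l1 l2 l3 : ℕ) → 0 < l0 →
          l0 * d0 + l1 * d1 ≡ l2 * d2 + l3 * d3 → l2 < b22 → l3 < b33 →
          DeletedPoint d0 d1 d2 d3 a00 b11 b12 b13 b21 b22 b23 b31 b32 b33
            (- (+ l1)) (+ l2) (+ l3)
  ptL2  : (l0 l1 l2 l3 : ℕ) → 0 < l0 →
          l0 * d0 + l2 * d2 ≡ l1 * d1 + l3 * d3 → l1 < b11 → l3 < b33 →
          DeletedPoint d0 d1 d2 d3 a00 b11 b12 b13 b21 b22 b23 b31 b32 b33
            (+ l1) (- (+ l2)) (+ l3)
  ptL3  : (l0 l1 l2 l3 : ℕ) → 0 < l0 →
          l0 * d0 + l3 * d3 ≡ l1 * d1 + l2 * d2 → l1 < b11 → l2 < b22 →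
          DeletedPoint d0 d1 d2 d3 a00 b11 b12 b13 b21 b22 b23 b31 b32 b33
            (+ l1) (+ l2) (- (+ l3))

InR : (d0 d1 d2 d3 a00 b11 b12 b13 b21 b22 b23 b31 b32 b33 i j k : ℕ) → Set
InR d0 d1 d2 d3 a00 b11 b12 b13 b21 b22 b23 b31 b32 b33 i j k =
  ∀ a b c → DeletedPoint d0 d1 d2 d3 a00 b11 b12 b13 b21 b22 b23 b31 b32 b33 a b c →
  ¬ RegionDeletes a b c i j k

label : (d1 d2 d3 i j k : ℕ) → ℕ
label d1 d2 d3 i j k = i * d1 + j * d2 + k * d3

-- Every label lies in S, so the claim is that [[i,j,k]] is deleted iff label − d0 ∈ S. Each
-- deleted point is p − n for a relation p·d = c d0 + n·d with c > 0, where p and n have disjoint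
-- supports, and [[i,j,k]] lies in its region iff (i,j,k) ≥ p; then
-- label = c d0 + (n + (i,j,k) − p)·d.
-- Conversely, label − d0 ∈ S is a relation with p = (i,j,k). Cancelling the common part of p and n
-- leaves disjoint supports. If p has one nonzero coordinate, minimality of b_rr shows the cube lies
-- in a region of type (ii); if two, it lies in one of those or in a region of type (iii); if n = 0,
-- then c ≥ a00, and either c = a00 (type (i)) or subtracting the a00-relation gives a relation of
-- smaller height c − a00, on which we recurse.
module Submission where

open import Defs
open import Data.Integer as ℤ using (ℤ; +≤+)
open import Data.Integer.Properties as ℤ using (neg-≤-pos)
open import Data.Nat using (ℕ; zero; suc; _+_; _*_; _≤_; _<_; z≤n; s≤s; _≤?_)
open import Data.Nat.Induction using (<-rec)
open import Data.Nat.Properties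
open import Algebra.Properties.CommutativeSemigroup +-commutativeSemigroup using (x∙yz≈y∙xz)
open import Data.Nat.Tactic.RingSolver using (solve-∀)
open import Data.Product using (Σ; ∃; _×_; _,_; proj₁; proj₂)
open import Data.Sum using (_⊎_; inj₁; inj₂)
open import Function.Base using (id)
open import Function.Bundles using (_⇔_; mk⇔; module Equivalence)
open Equivalence using (to; from)
open import Relation.Nullary using (yes; no; contradiction)
open import Relation.Binary.PropositionalEquality

≡⇔≡ : ∀ {a a′ b b′ : ℕ} → a ≡ a′ → b ≡ b′ → (a ≡ b) ⇔ (a′ ≡ b′)
≡⇔≡ refl refl = mk⇔ id id

≡⇔≡-swap : ∀ {a a′ b b′ : ℕ} → a ≡ b′ → b ≡ a′ → (a ≡ b) ⇔ (a′ ≡ b′)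
≡⇔≡-swap refl refl = mk⇔ sym sym

common-part : ∀ p n → ∃ λ m → ∃ λ p′ → ∃ λ n′ →
  m + p′ ≡ p × m + n′ ≡ n × (p′ ≡ 0 ⊎ n′ ≡ 0)
common-part zero    n       = 0 , 0 , n , refl , refl , inj₁ refl
common-part (suc p) zero    = 0 , suc p , 0 , refl , refl , inj₂ refl
common-part (suc p) (suc n) with common-part p n
... | m , p′ , n′ , refl , refl , disjoint = suc m , p′ , n′ , refl , refl , disjoint

0≢m*n+o : ∀ {m n o} → 0 < m → 0 < n → 0 ≢ m * n + o
0≢m*n+o (s≤s z≤n) (s≤s z≤n) ()

isD0PosMinRel⇒≤ : ∀ {d d0 x y b b0 bx by} → 0 < d0 →
  IsD0PosMinRel d d0 x y b b0 bx by →
  ∀ m c cx cy → 0 < c → m * d ≡ c * d0 + cx * x + cy * y → b ≤ m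
isD0PosMinRel⇒≤ (s≤s z≤n) _ zero _ _ _ (s≤s z≤n) ()
isD0PosMinRel⇒≤ _ (_ , _ , _ , minimal) (suc m) c cx cy c>0 eq =
  minimal (suc m) (s≤s z≤n) (c , cx , cy , c>0 , eq)

module Relations (d0 d1 d2 d3 : ℕ) where

  lab : ℕ → ℕ → ℕ → ℕ
  lab = label d1 d2 d3

  D0Relation : (c p₁ p₂ p₃ n₁ n₂ n₃ : ℕ) → Set
  D0Relation c p₁ p₂ p₃ n₁ n₂ n₃ = lab p₁ p₂ p₃ ≡ c * d0 + lab n₁ n₂ n₃

  MinusD0InS : ℕ → Set
  MinusD0InS s = Σ ℕ λ t → InS d0 d1 d2 d3 t × t + d0 ≡ s

  lab-+ : ∀ x₁ x₂ x₃ y₁ y₂ y₃ →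
    lab (x₁ + y₁) (x₂ + y₂) (x₃ + y₃) ≡ lab x₁ x₂ x₃ + lab y₁ y₂ y₃
  lab-+ x₁ x₂ x₃ y₁ y₂ y₃ = linear x₁ x₂ x₃ y₁ y₂ y₃ d1 d2 d3
    where
    linear : ∀ x₁ x₂ x₃ y₁ y₂ y₃ d1 d2 d3 →
      (x₁ + y₁) * d1 + (x₂ + y₂) * d2 + (x₃ + y₃) * d3 ≡
      (x₁ * d1 + x₂ * d2 + x₃ * d3) + (y₁ * d1 + y₂ * d2 + y₃ * d3)
    linear = solve-∀

  lab-x00 : ∀ x → lab x 0 0 ≡ x * d1
  lab-x00 x = trans (+-identityʳ _) (+-identityʳ _)

  lab-0y0 : ∀ y → lab 0 y 0 ≡ y * d2
  lab-0y0 y = +-identityʳ _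

  lab-x0z : ∀ x z → lab x 0 z ≡ x * d1 + z * d3
  lab-x0z x z = cong (_+ z * d3) (+-identityʳ _)

  lab-xy0 : ∀ x y → lab x y 0 ≡ x * d1 + y * d2
  lab-xy0 x y = +-identityʳ _

  D0Relation-x00⇔ : ∀ c x y z → D0Relation c x 0 0 0 y z ⇔ (x * d1 ≡ c * d0 + y * d2 + z * d3)
  D0Relation-x00⇔ c x y z = ≡⇔≡ (lab-x00 x) (sym (+-assoc (c * d0) _ _))

  D0Relation-0y0⇔ : ∀ c x y z → D0Relation c 0 y 0 x 0 z ⇔ (y * d2 ≡ c * d0 + x * d1 + z * d3)
  D0Relation-0y0⇔ c x y z =
    ≡⇔≡ (lab-0y0 y) (trans (cong (c * d0 +_) (lab-x0z x z)) (sym (+-assoc (c * d0) _ _)))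

  D0Relation-00z⇔ : ∀ c x y z → D0Relation c 0 0 z x y 0 ⇔ (z * d3 ≡ c * d0 + x * d1 + y * d2)
  D0Relation-00z⇔ c x y z =
    ≡⇔≡ refl (trans (cong (c * d0 +_) (lab-xy0 x y)) (sym (+-assoc (c * d0) _ _)))

  D0Relation-0yz⇔ : ∀ c x y z → D0Relation c 0 y z x 0 0 ⇔ (c * d0 + x * d1 ≡ y * d2 + z * d3)
  D0Relation-0yz⇔ c x y z = ≡⇔≡-swap refl (cong (c * d0 +_) (lab-x00 x))

  D0Relation-x0z⇔ : ∀ c x y z → D0Relation c x 0 z 0 y 0 ⇔ (c * d0 + y * d2 ≡ x * d1 + z * d3)
  D0Relation-x0z⇔ c x y z = ≡⇔≡-swap (lab-x0z x z) (cong (c * d0 +_) (lab-0y0 y))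

  D0Relation-xy0⇔ : ∀ c x y z → D0Relation c x y 0 0 0 z ⇔ (c * d0 + z * d3 ≡ x * d1 + y * d2)
  D0Relation-xy0⇔ c x y z = ≡⇔≡-swap (lab-xy0 x y) refl

  D0Relation-000⇔ : ∀ c x y z → D0Relation c x y z 0 0 0 ⇔ (c * d0 ≡ lab x y z)
  D0Relation-000⇔ c x y z = ≡⇔≡-swap refl (+-identityʳ _)

  suc-combination⇒MinusD0InS : ∀ c m₁ m₂ m₃ → MinusD0InS (suc c * d0 + lab m₁ m₂ m₃)
  suc-combination⇒MinusD0InS c m₁ m₂ m₃ =
    c * d0 + lab m₁ m₂ m₃ , (c , m₁ , m₂ , m₃ , regroup c m₁ m₂ m₃ d0 d1 d2 d3) ,
    add-d0 c m₁ m₂ m₃ d0 d1 d2 d3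
    where
    regroup : ∀ c m₁ m₂ m₃ d0 d1 d2 d3 →
      c * d0 + (m₁ * d1 + m₂ * d2 + m₃ * d3) ≡ c * d0 + m₁ * d1 + m₂ * d2 + m₃ * d3
    regroup = solve-∀
    add-d0 : ∀ c m₁ m₂ m₃ d0 d1 d2 d3 →
      c * d0 + (m₁ * d1 + m₂ * d2 + m₃ * d3) + d0 ≡
      suc c * d0 + (m₁ * d1 + m₂ * d2 + m₃ * d3)
    add-d0 = solve-∀

  D0Relation⇒MinusD0InS : ∀ {c p₁ p₂ p₃} i j k n₁ n₂ n₃ → 0 < c →
    D0Relation c p₁ p₂ p₃ n₁ n₂ n₃ → p₁ ≤ i → p₂ ≤ j → p₃ ≤ k → MinusD0InS (lab i j k)
  D0Relation⇒MinusD0InS {suc c} {p₁} {p₂} {p₃} _ _ _ n₁ n₂ n₃ _ rel p₁≤i p₂≤j p₃≤k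
    with m≤n⇒∃[o]m+o≡n p₁≤i | m≤n⇒∃[o]m+o≡n p₂≤j | m≤n⇒∃[o]m+o≡n p₃≤k
  ... | x , refl | y , refl | z , refl =
    subst MinusD0InS (sym lab≡) (suc-combination⇒MinusD0InS c (n₁ + x) (n₂ + y) (n₃ + z))
    where
    open ≡-Reasoning
    lab≡ : lab (p₁ + x) (p₂ + y) (p₃ + z) ≡ suc c * d0 + lab (n₁ + x) (n₂ + y) (n₃ + z)
    lab≡ = begin
      lab (p₁ + x) (p₂ + y) (p₃ + z)                ≡⟨ lab-+ p₁ p₂ p₃ x y z ⟩
      lab p₁ p₂ p₃ + lab x y z                      ≡⟨ cong (_+ lab x y z) rel ⟩
      suc c * d0 + lab n₁ n₂ n₃ + lab x y z         ≡⟨ +-assoc (suc c * d0) _ _ ⟩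
      suc c * d0 + (lab n₁ n₂ n₃ + lab x y z)       ≡⟨ cong (suc c * d0 +_) (lab-+ n₁ n₂ n₃ x y z) ⟨
      suc c * d0 + lab (n₁ + x) (n₂ + y) (n₃ + z)   ∎

  MinusD0InS⇒D0Relation : ∀ i j k → MinusD0InS (lab i j k) →
    ∃ λ c → ∃ λ n₁ → ∃ λ n₂ → ∃ λ n₃ → D0Relation (suc c) i j k n₁ n₂ n₃
  MinusD0InS⇒D0Relation i j k (_ , (c , n₁ , n₂ , n₃ , refl) , t+d0≡lab) =
    c , n₁ , n₂ , n₃ , trans (sym t+d0≡lab) (add-d0 c n₁ n₂ n₃ d0 d1 d2 d3)
    where
    add-d0 : ∀ c n₁ n₂ n₃ d0 d1 d2 d3 →
      c * d0 + n₁ * d1 + n₂ * d2 + n₃ * d3 + d0 ≡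
      suc c * d0 + (n₁ * d1 + n₂ * d2 + n₃ * d3)
    add-d0 = solve-∀

  D0Relation-cancel : ∀ c m₁ m₂ m₃ p₁ p₂ p₃ n₁ n₂ n₃ →
    D0Relation c (m₁ + p₁) (m₂ + p₂) (m₃ + p₃) (m₁ + n₁) (m₂ + n₂) (m₃ + n₃) →
    D0Relation c p₁ p₂ p₃ n₁ n₂ n₃
  D0Relation-cancel c m₁ m₂ m₃ p₁ p₂ p₃ n₁ n₂ n₃ rel =
    +-cancelˡ-≡ (lab m₁ m₂ m₃) _ _ (begin
      lab m₁ m₂ m₃ + lab p₁ p₂ p₃                   ≡⟨ lab-+ m₁ m₂ m₃ p₁ p₂ p₃ ⟨
      lab (m₁ + p₁) (m₂ + p₂) (m₃ + p₃)             ≡⟨ rel ⟩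
      c * d0 + lab (m₁ + n₁) (m₂ + n₂) (m₃ + n₃)    ≡⟨ cong (c * d0 +_) (lab-+ m₁ m₂ m₃ n₁ n₂ n₃) ⟩
      c * d0 + (lab m₁ m₂ m₃ + lab n₁ n₂ n₃)
        ≡⟨ x∙yz≈y∙xz (c * d0) (lab m₁ m₂ m₃) (lab n₁ n₂ n₃) ⟩
      lab m₁ m₂ m₃ + (c * d0 + lab n₁ n₂ n₃)        ∎)
    where open ≡-Reasoning

module Deletions (d0 d1 d2 d3 a00 b11 b10 b12 b13 b22 b20 b21 b23 b33 b30 b31 b32 : ℕ)
  (d0>0 : 0 < d0) (isA00 : IsA00 d0 d1 d2 d3 a00)
  (minRel₁ : IsD0PosMinRel d1 d0 d2 d3 b11 b10 b12 b13)
  (minRel₂ : IsD0PosMinRel d2 d0 d1 d3 b22 b20 b21 b23)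
  (minRel₃ : IsD0PosMinRel d3 d0 d1 d2 b33 b30 b31 b32) where

  open Relations d0 d1 d2 d3

  Removed : ℕ → ℕ → ℕ → Set
  Removed i j k = Σ ℤ λ a → Σ ℤ λ b → Σ ℤ λ c →
    DeletedPoint d0 d1 d2 d3 a00 b11 b12 b13 b21 b22 b23 b31 b32 b33 a b c ×
    RegionDeletes a b c i j k

  Removed-mono : ∀ {i j k i′ j′ k′} → i ≤ i′ → j ≤ j′ → k ≤ k′ →
    Removed i j k → Removed i′ j′ k′
  Removed-mono i≤i′ j≤j′ k≤k′ (a , b , c , point , a≤i , b≤j , c≤k) =
    a , b , c , point ,
    ℤ.≤-trans a≤i (+≤+ i≤i′) , ℤ.≤-trans b≤j (+≤+ j≤j′) , ℤ.≤-trans c≤k (+≤+ k≤k′)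

  removed-by-B1 : ∀ {i j k} → b11 ≤ i → Removed i j k
  removed-by-B1 b11≤i = _ , _ , _ , ptB1 , +≤+ b11≤i , neg-≤-pos , neg-≤-pos

  removed-by-B2 : ∀ {i j k} → b22 ≤ j → Removed i j k
  removed-by-B2 b22≤j = _ , _ , _ , ptB2 , neg-≤-pos , +≤+ b22≤j , neg-≤-pos

  removed-by-B3 : ∀ {i j k} → b33 ≤ k → Removed i j k
  removed-by-B3 b33≤k = _ , _ , _ , ptB3 , neg-≤-pos , neg-≤-pos , +≤+ b33≤k

  Removed⇒MinusD0InS : ∀ i j k → Removed i j k → MinusD0InS (lab i j k)
  Removed⇒MinusD0InS i j k (_ , _ , _ , ptA a₁ a₂ a₃ rel , +≤+ a₁≤i , +≤+ a₂≤j , +≤+ a₃≤k) =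
    D0Relation⇒MinusD0InS i j k 0 0 0 (proj₁ isA00)
      (from (D0Relation-000⇔ a00 a₁ a₂ a₃) rel) a₁≤i a₂≤j a₃≤k
  Removed⇒MinusD0InS i j k (_ , _ , _ , ptB1 , +≤+ b11≤i , _ , _) =
    D0Relation⇒MinusD0InS i j k 0 b12 b13 (proj₁ (proj₂ minRel₁))
      (from (D0Relation-x00⇔ b10 b11 b12 b13) (proj₁ (proj₂ (proj₂ minRel₁)))) b11≤i z≤n z≤n
  Removed⇒MinusD0InS i j k (_ , _ , _ , ptB2 , _ , +≤+ b22≤j , _) =
    D0Relation⇒MinusD0InS i j k b21 0 b23 (proj₁ (proj₂ minRel₂))
      (from (D0Relation-0y0⇔ b20 b21 b22 b23) (proj₁ (proj₂ (proj₂ minRel₂)))) z≤n b22≤j z≤n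
  Removed⇒MinusD0InS i j k (_ , _ , _ , ptB3 , _ , _ , +≤+ b33≤k) =
    D0Relation⇒MinusD0InS i j k b31 b32 0 (proj₁ (proj₂ minRel₃))
      (from (D0Relation-00z⇔ b30 b31 b32 b33) (proj₁ (proj₂ (proj₂ minRel₃)))) z≤n z≤n b33≤k
  Removed⇒MinusD0InS i j k (_ , _ , _ , ptL1 l₀ l₁ l₂ l₃ l₀>0 rel _ _ , _ , +≤+ l₂≤j , +≤+ l₃≤k) =
    D0Relation⇒MinusD0InS i j k l₁ 0 0 l₀>0
      (from (D0Relation-0yz⇔ l₀ l₁ l₂ l₃) rel) z≤n l₂≤j l₃≤k
  Removed⇒MinusD0InS i j k (_ , _ , _ , ptL2 l₀ l₁ l₂ l₃ l₀>0 rel _ _ , +≤+ l₁≤i , _ , +≤+ l₃≤k) =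
    D0Relation⇒MinusD0InS i j k 0 l₂ 0 l₀>0
      (from (D0Relation-x0z⇔ l₀ l₁ l₂ l₃) rel) l₁≤i z≤n l₃≤k
  Removed⇒MinusD0InS i j k (_ , _ , _ , ptL3 l₀ l₁ l₂ l₃ l₀>0 rel _ _ , +≤+ l₁≤i , +≤+ l₂≤j , _) =
    D0Relation⇒MinusD0InS i j k 0 0 l₃ l₀>0
      (from (D0Relation-xy0⇔ l₀ l₁ l₂ l₃) rel) l₁≤i l₂≤j z≤n

  RelationRemoves : ℕ → Set
  RelationRemoves c = ∀ p₁ p₂ p₃ n₁ n₂ n₃ → 0 < c →
    D0Relation c p₁ p₂ p₃ n₁ n₂ n₃ → Removed p₁ p₂ p₃

  d0-multiple-removes : ∀ c p₁ p₂ p₃ → (∀ {c′} → c′ < c → RelationRemoves c′) → 0 < c →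
    c * d0 ≡ lab p₁ p₂ p₃ → Removed p₁ p₂ p₃
  d0-multiple-removes c p₁ p₂ p₃ IH c>0 rel
    with m≤n⇒∃[o]m+o≡n (proj₂ (proj₂ isA00) c c>0 (p₁ , p₂ , p₃ , rel))
  ... | zero , refl =
    _ , _ , _ , ptA p₁ p₂ p₃ (trans (cong (_* d0) (sym (+-identityʳ a00))) rel) ,
    ℤ.≤-refl , ℤ.≤-refl , ℤ.≤-refl
  ... | suc c′ , refl =
    IH (m<n+m (suc c′) (proj₁ isA00)) p₁ p₂ p₃ a₁ a₂ a₃ (s≤s z≤n) reduced
    where
    open ≡-Reasoning
    a₁ a₂ a₃ : ℕ
    a₁ = proj₁ (proj₁ (proj₂ isA00))
    a₂ = proj₁ (proj₂ (proj₁ (proj₂ isA00)))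
    a₃ = proj₁ (proj₂ (proj₂ (proj₁ (proj₂ isA00))))
    a00-relation : a00 * d0 ≡ lab a₁ a₂ a₃
    a00-relation = proj₂ (proj₂ (proj₂ (proj₁ (proj₂ isA00))))
    reduced : D0Relation (suc c′) p₁ p₂ p₃ a₁ a₂ a₃
    reduced = begin
      lab p₁ p₂ p₃                  ≡⟨ rel ⟨
      (a00 + suc c′) * d0           ≡⟨ *-distribʳ-+ d0 a00 (suc c′) ⟩
      a00 * d0 + suc c′ * d0        ≡⟨ +-comm (a00 * d0) _ ⟩
      suc c′ * d0 + a00 * d0        ≡⟨ cong (suc c′ * d0 +_) a00-relation ⟩
      suc c′ * d0 + lab a₁ a₂ a₃    ∎

  disjoint-relation-removes : ∀ c → (∀ {c′} → c′ < c → RelationRemoves c′) →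
    ∀ p₁ p₂ p₃ n₁ n₂ n₃ → (p₁ ≡ 0 ⊎ n₁ ≡ 0) → (p₂ ≡ 0 ⊎ n₂ ≡ 0) → (p₃ ≡ 0 ⊎ n₃ ≡ 0) →
    0 < c → D0Relation c p₁ p₂ p₃ n₁ n₂ n₃ → Removed p₁ p₂ p₃
  disjoint-relation-removes c IH _ _ _ _ _ _ (inj₁ refl) (inj₁ refl) (inj₁ refl) c>0 rel =
    contradiction rel (0≢m*n+o c>0 d0>0)
  disjoint-relation-removes c IH p₁ _ _ _ n₂ n₃ (inj₂ refl) (inj₁ refl) (inj₁ refl) c>0 rel =
    removed-by-B1 (isD0PosMinRel⇒≤ {bx = b12} {by = b13} d0>0 minRel₁ p₁ c n₂ n₃ c>0
      (to (D0Relation-x00⇔ c p₁ n₂ n₃) rel))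
  disjoint-relation-removes c IH _ p₂ _ n₁ _ n₃ (inj₁ refl) (inj₂ refl) (inj₁ refl) c>0 rel =
    removed-by-B2 (isD0PosMinRel⇒≤ {bx = b21} {by = b23} d0>0 minRel₂ p₂ c n₁ n₃ c>0
      (to (D0Relation-0y0⇔ c n₁ p₂ n₃) rel))
  disjoint-relation-removes c IH _ _ p₃ n₁ n₂ _ (inj₁ refl) (inj₁ refl) (inj₂ refl) c>0 rel =
    removed-by-B3 (isD0PosMinRel⇒≤ {bx = b31} {by = b32} d0>0 minRel₃ p₃ c n₁ n₂ c>0
      (to (D0Relation-00z⇔ c n₁ n₂ p₃) rel))
  disjoint-relation-removes c IH _ p₂ p₃ n₁ _ _ (inj₁ refl) (inj₂ refl) (inj₂ refl) c>0 rel
    with b22 ≤? p₂ | b33 ≤? p₃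
  ... | yes b22≤p₂ | _          = removed-by-B2 b22≤p₂
  ... | no _       | yes b33≤p₃ = removed-by-B3 b33≤p₃
  ... | no b22≰p₂  | no b33≰p₃  =
    _ , _ , _ ,
    ptL1 c n₁ p₂ p₃ c>0 (to (D0Relation-0yz⇔ c n₁ p₂ p₃) rel) (≰⇒> b22≰p₂) (≰⇒> b33≰p₃) ,
    neg-≤-pos , ℤ.≤-refl , ℤ.≤-refl
  disjoint-relation-removes c IH p₁ _ p₃ _ n₂ _ (inj₂ refl) (inj₁ refl) (inj₂ refl) c>0 rel
    with b11 ≤? p₁ | b33 ≤? p₃
  ... | yes b11≤p₁ | _          = removed-by-B1 b11≤p₁
  ... | no _       | yes b33≤p₃ = removed-by-B3 b33≤p₃
  ... | no b11≰p₁  | no b33≰p₃  =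
    _ , _ , _ ,
    ptL2 c p₁ n₂ p₃ c>0 (to (D0Relation-x0z⇔ c p₁ n₂ p₃) rel) (≰⇒> b11≰p₁) (≰⇒> b33≰p₃) ,
    ℤ.≤-refl , neg-≤-pos , ℤ.≤-refl
  disjoint-relation-removes c IH p₁ p₂ _ _ _ n₃ (inj₂ refl) (inj₂ refl) (inj₁ refl) c>0 rel
    with b11 ≤? p₁ | b22 ≤? p₂
  ... | yes b11≤p₁ | _          = removed-by-B1 b11≤p₁
  ... | no _       | yes b22≤p₂ = removed-by-B2 b22≤p₂
  ... | no b11≰p₁  | no b22≰p₂  =
    _ , _ , _ ,
    ptL3 c p₁ p₂ n₃ c>0 (to (D0Relation-xy0⇔ c p₁ p₂ n₃) rel) (≰⇒> b11≰p₁) (≰⇒> b22≰p₂) ,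
    ℤ.≤-refl , ℤ.≤-refl , neg-≤-pos
  disjoint-relation-removes c IH p₁ p₂ p₃ _ _ _ (inj₂ refl) (inj₂ refl) (inj₂ refl) c>0 rel =
    d0-multiple-removes c p₁ p₂ p₃ IH c>0 (to (D0Relation-000⇔ c p₁ p₂ p₃) rel)

  relation-removes : ∀ c → RelationRemoves c
  relation-removes = <-rec RelationRemoves cancel-and-remove
    where
    cancel-and-remove : ∀ c → (∀ {c′} → c′ < c → RelationRemoves c′) → RelationRemoves c
    cancel-and-remove c IH p₁ p₂ p₃ n₁ n₂ n₃ c>0 rel
      with common-part p₁ n₁ | common-part p₂ n₂ | common-part p₃ n₃
    ... | m₁ , p₁′ , n₁′ , refl , refl , disjoint₁
        | m₂ , p₂′ , n₂′ , refl , refl , disjoint₂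
        | m₃ , p₃′ , n₃′ , refl , refl , disjoint₃ =
      Removed-mono (m≤n+m p₁′ m₁) (m≤n+m p₂′ m₂) (m≤n+m p₃′ m₃)
        (disjoint-relation-removes c IH p₁′ p₂′ p₃′ n₁′ n₂′ n₃′ disjoint₁ disjoint₂ disjoint₃ c>0
          (D0Relation-cancel c m₁ m₂ m₃ p₁′ p₂′ p₃′ n₁′ n₂′ n₃′ rel))

  MinusD0InS⇒Removed : ∀ i j k → MinusD0InS (lab i j k) → Removed i j k
  MinusD0InS⇒Removed i j k below =
    let c , n₁ , n₂ , n₃ , rel = MinusD0InS⇒D0Relation i j k below
    in relation-removes (suc c) i j k n₁ n₂ n₃ (s≤s z≤n) rel

theorem2p2 : (d0 d1 d2 d3 : ℕ) → EmbDim4 d0 d1 d2 d3 →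
    (a00 : ℕ) → IsA00 d0 d1 d2 d3 a00 →
    (b11 b10 b12 b13 : ℕ) → IsD0PosMinRel d1 d0 d2 d3 b11 b10 b12 b13 →
    (b22 b20 b21 b23 : ℕ) → IsD0PosMinRel d2 d0 d1 d3 b22 b20 b21 b23 →
    (b33 b30 b31 b32 : ℕ) → IsD0PosMinRel d3 d0 d1 d2 b33 b30 b31 b32 →
    (i j k : ℕ) →
    InR d0 d1 d2 d3 a00 b11 b12 b13 b21 b22 b23 b31 b32 b33 i j k
      ⇔ Ap d0 d1 d2 d3 (label d1 d2 d3 i j k)
theorem2p2 d0 d1 d2 d3 ((d0>0 , _) , _) a00 isA00 b11 b10 b12 b13 minRel₁
  b22 b20 b21 b23 minRel₂ b33 b30 b31 b32 minRel₃ i j k = mk⇔ inR⇒Ap Ap⇒inR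
  where
  open Relations d0 d1 d2 d3
  open Deletions d0 d1 d2 d3 a00 b11 b10 b12 b13 b22 b20 b21 b23 b33 b30 b31 b32
    d0>0 isA00 minRel₁ minRel₂ minRel₃

  inR⇒Ap : InR d0 d1 d2 d3 a00 b11 b12 b13 b21 b22 b23 b31 b32 b33 i j k →
    Ap d0 d1 d2 d3 (lab i j k)
  inR⇒Ap inR = (0 , i , j , k , refl) , λ below →
    let a , b , c , point , deletes = MinusD0InS⇒Removed i j k below in inR a b c point deletes

  Ap⇒inR : Ap d0 d1 d2 d3 (lab i j k) →
    InR d0 d1 d2 d3 a00 b11 b12 b13 b21 b22 b23 b31 b32 b33 i j k
  Ap⇒inR (_ , ¬below) a b c point deletes =
    ¬below (Removed⇒MinusD0InS i j k (a , b , c , point , deletes))
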